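{- Let $(T_1,r_1)$ and $(T_2,r_2)$ be rooted trees with $V(T_1)\cap V(T_2)=\emptyset$, let $(T,r_1)=(T_1,r_1)\circ(T_2,r_2)$, let $f:V(T)\to\{0,1,2\}$, and let $f_1=f|_{V(T_1)}$, $f_2=f|_{V(T_2)}$. Then $(T,f,r_1)\in C$ if and only if the pair of classes $(X,Y)$ with $(T_1,f_1,r_1)\in X$ and $(T_2,f_2,r_2)\in Y$ can be chosen among $(C,A),(C,B),(C,C),(D,A),(D,B),(E,A)$.
   Context: For a graph (or forest) $G$, an independent Roman $\{2\}$-dominating function (IR2DF) is a function $f:V(G)\to\{0,1,2\}$ such that every vertex $v$ with $f(v)=0$ satisfies $\sum_{u\in N(v)}f(u)\ge 2$ and the set $\{v: f(v)>0\}$ is independent; the empty function on the empty graph is regarded as an IR2DF. A rooted tree is a pair $(T,r)$ with $T$ a tree and $r\in V(T)$. For rooted trees with disjoint vertex sets, the composition $(T_1,r_1)\circ(T_2,r_2)=(T,r_1)$ has $V(T)=V(T_1)\cup V(T_2)$ and $E(T)=E(T_1)\cup E(T_2)\cup\{r_1r_2\}$. For a rooted tree $(T,r)$ and $f:V(T)\to\{0,1,2\}$, let $IR2DF(T)$ be the set of IR2DFs of $T$, $IR2DF_r(T)=\{f: f\notin IR2DF(T)$ and $f|_{V(T)\setminus\{r\}}\in IR2DF(T-r)\}$, and $f(N[r])=\sum_{u\in N_T[r]}f(u)$. Define the classes of triples: $A=\{(T,f,r): f\in IR2DF(T), f(r)=2\}$; $B=\{(T,f,r): f\in IR2DF(T),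 f(r)=1\}$; $C=\{(T,f,r): f\in IR2DF(T), f(r)=0\}$; $D=\{(T,f,r): f\in IR2DF_r(T), f(N[r])=1\}$; $E=\{(T,f,r): f\in IR2DF_r(T), f(N[r])=0\}$. -}

module Defs where

open import Data.Nat using (ℕ; zero; suc; _+_; _≤_)
open import Data.Fin using (Fin; zero; suc; toℕ; splitAt; _↑ˡ_; _↑ʳ_; punchIn; inject₁; fromℕ; _≟_)
open import Data.Bool using (Bool; true; false; if_then_else_; _∧_)
open import Data.Sum using (_⊎_; inj₁; inj₂)
open import Data.Product using (_×_; Σ; ∃; _,_)
open import Relation.Nullary using (¬_)
open import Relation.Nullary.Decidable using (⌊_⌋)
open import Relation.Binary.PropositionalEquality using (_≡_; refl)
open import Function using (_∘_)
open import Function.Definitions using (Injective)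

record Graph (n : ℕ) : Set where
  field
    adj        : Fin n → Fin n → Bool
    adj-sym    : ∀ i j → adj i j ≡ adj j i
    adj-irrefl : ∀ i → adj i i ≡ false
open Graph public

data Walk {n : ℕ} (G : Graph n) : Fin n → Fin n → Set where
  here : ∀ {u} → Walk G u u
  step : ∀ {u w v} → adj G u w ≡ true → Walk G w v → Walk G u v

Connected : ∀ {n} → Graph n → Set
Connected G = ∀ u v → Walk G u v

record Cycle {n : ℕ} (G : Graph n) : Set where
  field
    k      : ℕ
    c      : Fin (suc (suc (suc k))) → Fin n
    c-inj  : Injective _≡_ _≡_ c
    c-step : ∀ (i : Fin (suc (suc k))) → adj G (c (inject₁ i)) (c (suc i)) ≡ true
    c-close : adj G (c (fromℕ (suc (suc k)))) (c zero) ≡ true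

Acyclic : ∀ {n} → Graph n → Set
Acyclic G = ¬ Cycle G

IsTree : ∀ {n} → Graph n → Set
IsTree G = Connected G × Acyclic G

∑ : ∀ {n} → (Fin n → ℕ) → ℕ
∑ {zero}  g = 0
∑ {suc n} g = g zero + ∑ (g ∘ suc)

Labelling : ℕ → Set
Labelling n = Fin n → Fin 3

nsum : ∀ {n} → Graph n → Labelling n → Fin n → ℕ
nsum G f v = ∑ (λ u → if adj G v u then toℕ (f u) else 0)

IsIR2DF : ∀ {n} → Graph n → Labelling n → Set
IsIR2DF G f =
  (∀ v → f v ≡ zero → 2 ≤ nsum G f v) ×
  (∀ u v → adj G u v ≡ true → f u ≡ zero ⊎ f v ≡ zero)

-- T - r : induced subgraph on V \ {r}, vertices renumbered via punchIn r
delete : ∀ {m} → Graph (suc m) → Fin (suc m) → Graph m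
delete G r = record
  { adj = λ i j → adj G (punchIn r i) (punchIn r j)
  ; adj-sym = λ i j → adj-sym G (punchIn r i) (punchIn r j)
  ; adj-irrefl = λ i → adj-irrefl G (punchIn r i) }

IsIR2DF-r : ∀ {m} → Graph (suc m) → Labelling (suc m) → Fin (suc m) → Set
IsIR2DF-r G f r = ¬ IsIR2DF G f × IsIR2DF (delete G r) (f ∘ punchIn r)

closedSum : ∀ {n} → Graph n → Labelling n → Fin n → ℕ
closedSum G f r = toℕ (f r) + nsum G f r

InA InB InC InD InE : ∀ {m} → Graph (suc m) → Labelling (suc m) → Fin (suc m) → Set
InA G f r = IsIR2DF G f × toℕ (f r) ≡ 2
InB G f r = IsIR2DF G f × toℕ (f r) ≡ 1
InC G f r = IsIR2DF G f × toℕ (f r) ≡ 0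
InD G f r = IsIR2DF-r G f r × closedSum G f r ≡ 1
InE G f r = IsIR2DF-r G f r × closedSum G f r ≡ 0

-- composition (T1,r1) ∘ (T2,r2): vertices Fin n1 ⊎ Fin n2 encoded as Fin (n1 + n2)
-- (T1 via _↑ˡ n2, T2 via n1 ↑ʳ_), plus the single edge r1 r2.
compAdj : ∀ {n₁ n₂} → Graph n₁ → Fin n₁ → Graph n₂ → Fin n₂ →
          Fin n₁ ⊎ Fin n₂ → Fin n₁ ⊎ Fin n₂ → Bool
compAdj G₁ r₁ G₂ r₂ (inj₁ a) (inj₁ b) = adj G₁ a b
compAdj G₁ r₁ G₂ r₂ (inj₂ a) (inj₂ b) = adj G₂ a b
compAdj G₁ r₁ G₂ r₂ (inj₁ a) (inj₂ b) = ⌊ a ≟ r₁ ⌋ ∧ ⌊ b ≟ r₂ ⌋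
compAdj G₁ r₁ G₂ r₂ (inj₂ b) (inj₁ a) = ⌊ a ≟ r₁ ⌋ ∧ ⌊ b ≟ r₂ ⌋

compAdj-sym : ∀ {n₁ n₂} (G₁ : Graph n₁) r₁ (G₂ : Graph n₂) r₂ x y →
              compAdj G₁ r₁ G₂ r₂ x y ≡ compAdj G₁ r₁ G₂ r₂ y x
compAdj-sym G₁ r₁ G₂ r₂ (inj₁ a) (inj₁ b) = adj-sym G₁ a b
compAdj-sym G₁ r₁ G₂ r₂ (inj₂ a) (inj₂ b) = adj-sym G₂ a b
compAdj-sym G₁ r₁ G₂ r₂ (inj₁ a) (inj₂ b) = refl
compAdj-sym G₁ r₁ G₂ r₂ (inj₂ b) (inj₁ a) = refl

compAdj-irrefl : ∀ {n₁ n₂} (G₁ : Graph n₁) r₁ (G₂ : Graph n₂) r₂ x →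
                 compAdj G₁ r₁ G₂ r₂ x x ≡ false
compAdj-irrefl G₁ r₁ G₂ r₂ (inj₁ a) = adj-irrefl G₁ a
compAdj-irrefl G₁ r₁ G₂ r₂ (inj₂ a) = adj-irrefl G₂ a

compose : ∀ {n₁ n₂} → Graph n₁ → Fin n₁ → Graph n₂ → Fin n₂ → Graph (n₁ + n₂)
compose {n₁} G₁ r₁ G₂ r₂ = record
  { adj = λ i j → compAdj G₁ r₁ G₂ r₂ (splitAt n₁ i) (splitAt n₁ j)
  ; adj-sym = λ i j → compAdj-sym G₁ r₁ G₂ r₂ (splitAt n₁ i) (splitAt n₁ j)
  ; adj-irrefl = λ i → compAdj-irrefl G₁ r₁ G₂ r₂ (splitAt n₁ i) }

restrict₁ : ∀ {n₁ n₂} → Labelling (n₁ + n₂) → Labelling n₁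
restrict₁ {n₁} {n₂} f i = f (i ↑ˡ n₂)

restrict₂ : ∀ {n₁ n₂} → Labelling (n₁ + n₂) → Labelling n₂
restrict₂ {n₁} {n₂} f j = f (n₁ ↑ʳ j)

-- A triple in C, D or E has f(r) = 0, and f is an IR2DF of T except that r itself need not be
-- dominated; the three classes are told apart by f(N(r)) being ≥ 2, = 1 or = 0 (for D, a root
-- label 1 with f(N[r]) = 1 would leave r without labelled neighbours and make f an IR2DF).
-- In T₁ ∘ T₂ the root r₁ gains the single neighbour r₂, which adds f(r₂) to f(N(r₁)), and
-- f(r₁) = 0 leaves every neighbourhood sum inside T₂ unchanged. So (T, f, r₁) ∈ C iff f₁ is such
-- an IR2DF away from r₁, f₂ is an IR2DF of T₂ and f₁(N(r₁)) + f₂(r₂) ≥ 2; the six solutions of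
-- this inequality with f₂(r₂) ∈ {0, 1, 2} are the six class pairs.

module Submission where

open import Defs
open import Data.Bool using (Bool; true; false; if_then_else_; _∧_)
open import Data.Bool.Properties using (∧-comm; if-eta)
open import Data.Empty using (⊥-elim)
open import Data.Fin using (Fin; zero; suc; toℕ; _↑ˡ_; _↑ʳ_; splitAt; punchIn; punchOut; _≟_)
open import Data.Fin.Properties
  using ( toℕ-injective; toℕ≤pred[n]; splitAt-↑ˡ; splitAt-↑ʳ; splitAt⁻¹-↑ˡ; splitAt⁻¹-↑ʳ
        ; punchIn-punchOut; punchInᵢ≢i)
open import Data.Nat using (ℕ; zero; suc; _+_; _≤_; _<_; z≤n; s≤s)
open import Data.Nat.Properties
  using ( +-0-commutativeMonoid; suc-injective; +-assoc; +-identityʳ; m≤m+n; m≤n+m; ≤-trans; <⇒≱; 1+n≢0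
        ; m+n≡0⇒m≡0; m+n≡0⇒n≡0)
open import Algebra.Properties.CommutativeMonoid.Sum +-0-commutativeMonoid using (sum; sum-remove; sum-cong-≗)
open import Data.Product using (_×_; _,_; proj₁)
open import Data.Sum using (_⊎_; inj₁; inj₂; swap)
open import Function using (_∘_; _⇔_; mk⇔; Equivalence)
open import Function.Construct.Composition using (_⇔-∘_)
open import Function.Construct.Symmetry using (⇔-sym)
open import Relation.Nullary using (yes; no)
open import Relation.Nullary.Decidable using (⌊_⌋)
open import Relation.Binary.PropositionalEquality
  using (_≡_; _≢_; refl; sym; trans; cong; cong₂; subst; module ≡-Reasoning)

open Equivalence using (to; from)

∑≡sum : ∀ {n} (h : Fin n → ℕ) → ∑ h ≡ sum h
∑≡sum {zero}  h = refl
∑≡sum {suc n} h = cong (h zero +_) (∑≡sum (h ∘ suc))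

∑-cong : ∀ {n} {g h : Fin n → ℕ} → (∀ i → g i ≡ h i) → ∑ g ≡ ∑ h
∑-cong {g = g} {h} g≗h = trans (∑≡sum g) (trans (sum-cong-≗ g≗h) (sym (∑≡sum h)))

∑-punchIn : ∀ {m} (r : Fin (suc m)) (h : Fin (suc m) → ℕ) → ∑ h ≡ h r + ∑ (h ∘ punchIn r)
∑-punchIn r h = trans (∑≡sum h) (trans (sum-remove h) (cong (h r +_) (sym (∑≡sum (h ∘ punchIn r)))))

∑-zero : ∀ {n} {h : Fin n → ℕ} → (∀ i → h i ≡ 0) → ∑ h ≡ 0
∑-zero {zero}  h≗0 = refl
∑-zero {suc n} h≗0 = cong₂ _+_ (h≗0 zero) (∑-zero (h≗0 ∘ suc))

∑≡0⇒≡0 : ∀ {n} {h : Fin n → ℕ} → ∑ h ≡ 0 → ∀ i → h i ≡ 0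
∑≡0⇒≡0 {suc _} {h} ∑h≡0 i = m+n≡0⇒m≡0 (h i) (trans (sym (∑-punchIn i h)) ∑h≡0)

∑-single : ∀ {m} (r : Fin (suc m)) {h : Fin (suc m) → ℕ} → (∀ i → i ≢ r → h i ≡ 0) → ∑ h ≡ h r
∑-single r {h} h≗0 = begin
  ∑ h                     ≡⟨ ∑-punchIn r h ⟩
  h r + ∑ (h ∘ punchIn r) ≡⟨ cong (h r +_) (∑-zero (λ i → h≗0 (punchIn r i) (punchInᵢ≢i r i))) ⟩
  h r + 0                 ≡⟨ +-identityʳ (h r) ⟩
  h r                     ∎
  where open ≡-Reasoning

∑-select : ∀ {m} (c : Bool) (r : Fin (suc m)) (h : Fin (suc m) → ℕ) →
           ∑ (λ j → if c ∧ ⌊ j ≟ r ⌋ then h j else 0) ≡ (if c then h r else 0)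
∑-select {m} false r h = ∑-zero {suc m} {λ _ → 0} (λ _ → refl)
∑-select true  r h with r ≟ r | ∑-single r {λ j → if ⌊ j ≟ r ⌋ then h j else 0} off-r
  where
  off-r : ∀ j → j ≢ r → (if ⌊ j ≟ r ⌋ then h j else 0) ≡ 0
  off-r j j≢r with j ≟ r
  ... | yes j≡r = ⊥-elim (j≢r j≡r)
  ... | no _    = refl
... | yes _   | ∑≡h[r] = ∑≡h[r]
... | no r≢r  | _      = ⊥-elim (r≢r refl)

∑-splitAt : ∀ m n (h : Fin (m + n) → ℕ) → ∑ h ≡ ∑ (h ∘ (_↑ˡ n)) + ∑ (h ∘ (m ↑ʳ_))
∑-splitAt zero    n h = refl
∑-splitAt (suc m) n h = trans (cong (h zero +_) (∑-splitAt m n (h ∘ suc))) (sym (+-assoc (h zero) _ _))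

if-then-0 : ∀ b {x : ℕ} → x ≡ 0 → (if b then x else 0) ≡ 0
if-then-0 b x≡0 = trans (cong (λ y → if b then y else 0) x≡0) (if-eta b)

weight : ∀ {n} → Labelling n → Bool → Fin n → ℕ
weight f b u = if b then toℕ (f u) else 0

data PunchInView {m} (r : Fin (suc m)) : Fin (suc m) → Set where
  root    : PunchInView r r
  nonroot : ∀ i → PunchInView r (punchIn r i)

punchInView : ∀ {m} (r v : Fin (suc m)) → PunchInView r v
punchInView r v with v ≟ r
... | yes refl = root
... | no v≢r   = subst (PunchInView r) (punchIn-punchOut (v≢r ∘ sym)) (nonroot (punchOut (v≢r ∘ sym)))

Independent : ∀ {n} → Graph n → Labelling n → Set
Independent G f = ∀ u v → adj G u v ≡ true → f u ≡ zero ⊎ f v ≡ zero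

DominatedAwayFrom : ∀ {n} → Graph n → Labelling n → Fin n → Set
DominatedAwayFrom G f r = ∀ v → v ≢ r → f v ≡ zero → 2 ≤ nsum G f v

IsIR2DF-except : ∀ {n} → Graph n → Labelling n → Fin n → Set
IsIR2DF-except G f r = toℕ (f r) ≡ 0 × DominatedAwayFrom G f r × Independent G f

module _ {m} (T : Graph (suc m)) (r : Fin (suc m)) (g : Labelling (suc m)) where

  nsum-punchIn : ∀ i → nsum T g (punchIn r i)
                       ≡ weight g (adj T (punchIn r i) r) r + nsum (delete T r) (g ∘ punchIn r) i
  nsum-punchIn i = ∑-punchIn r (λ u → weight g (adj T (punchIn r i) u) u)

  nsum-delete≤ : ∀ i → nsum (delete T r) (g ∘ punchIn r) i ≤ nsum T g (punchIn r i)
  nsum-delete≤ i = subst (nsum (delete T r) (g ∘ punchIn r) i ≤_) (sym (nsum-punchIn i)) (m≤n+m _ _)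

  nsum-delete : toℕ (g r) ≡ 0 → ∀ i → nsum (delete T r) (g ∘ punchIn r) i ≡ nsum T g (punchIn r i)
  nsum-delete g[r]≡0 i = sym (trans (nsum-punchIn i)
    (cong (_+ nsum (delete T r) (g ∘ punchIn r) i) (if-then-0 (adj T (punchIn r i) r) g[r]≡0)))

  nsum≡0⇒neighbour≡0 : nsum T g r ≡ 0 → ∀ v → adj T r v ≡ true → g v ≡ zero
  nsum≡0⇒neighbour≡0 s≡0 v rv = toℕ-injective
    (subst (λ b → weight g b v ≡ 0) rv (∑≡0⇒≡0 {h = λ u → weight g (adj T r u) u} s≡0 v))

  delete-IR2DF⇒DominatedAwayFrom : IsIR2DF (delete T r) (g ∘ punchIn r) → DominatedAwayFrom T g r
  delete-IR2DF⇒DominatedAwayFrom (dom , _) v v≢r g[v]≡0 with punchInView r v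
  ... | root      = ⊥-elim (v≢r refl)
  ... | nonroot i = ≤-trans (dom i g[v]≡0) (nsum-delete≤ i)

  delete-IR2DF⇒Independent : IsIR2DF (delete T r) (g ∘ punchIn r) →
                             (∀ v → adj T r v ≡ true → g r ≡ zero ⊎ g v ≡ zero) → Independent T g
  delete-IR2DF⇒Independent (_ , ind) root-ok u v uv with punchInView r u | punchInView r v
  ... | root      | _         = root-ok v uv
  ... | nonroot i | root      = swap (root-ok (punchIn r i) (trans (adj-sym T r _) uv))
  ... | nonroot i | nonroot j = ind i j uv

  IsIR2DF-except⇒delete-IR2DF : IsIR2DF-except T g r → IsIR2DF (delete T r) (g ∘ punchIn r)
  IsIR2DF-except⇒delete-IR2DF (g[r]≡0 , dom , ind) =
    (λ i g[i]≡0 → subst (2 ≤_) (sym (nsum-delete g[r]≡0 i))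
                                (dom (punchIn r i) (punchInᵢ≢i r i) g[i]≡0)) ,
    (λ i j → ind (punchIn r i) (punchIn r j))

  IsIR2DF-except⇒IsIR2DF : 2 ≤ nsum T g r → IsIR2DF-except T g r → IsIR2DF T g
  IsIR2DF-except⇒IsIR2DF 2≤s (_ , dom , ind) = dominated , ind
    where
    dominated : ∀ v → g v ≡ zero → 2 ≤ nsum T g v
    dominated v g[v]≡0 with v ≟ r
    ... | yes refl = 2≤s
    ... | no v≢r   = dom v v≢r g[v]≡0

  IsIR2DF-except⇒IsIR2DF-r : nsum T g r < 2 → IsIR2DF-except T g r → IsIR2DF-r T g r
  IsIR2DF-except⇒IsIR2DF-r s<2 ex@(g[r]≡0 , _) =
    (λ (dom , _) → <⇒≱ s<2 (dom r (toℕ-injective g[r]≡0))) , IsIR2DF-except⇒delete-IR2DF ex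

  IsIR2DF-r⇒IsIR2DF-except : toℕ (g r) ≡ 0 → IsIR2DF-r T g r → IsIR2DF-except T g r
  IsIR2DF-r⇒IsIR2DF-except g[r]≡0 (_ , ir) =
    g[r]≡0 , delete-IR2DF⇒DominatedAwayFrom ir ,
    delete-IR2DF⇒Independent ir (λ _ _ → inj₁ (toℕ-injective g[r]≡0))

  isolated-root⇒IsIR2DF : g r ≢ zero → nsum T g r ≡ 0 → IsIR2DF (delete T r) (g ∘ punchIn r) →
                          IsIR2DF T g
  isolated-root⇒IsIR2DF g[r]≢0 s≡0 ir =
    dominated , delete-IR2DF⇒Independent ir (λ v rv → inj₂ (nsum≡0⇒neighbour≡0 s≡0 v rv))
    where
    dominated : ∀ v → g v ≡ zero → 2 ≤ nsum T g v
    dominated v g[v]≡0 with v ≟ r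
    ... | yes refl = ⊥-elim (g[r]≢0 g[v]≡0)
    ... | no v≢r   = delete-IR2DF⇒DominatedAwayFrom ir v v≢r g[v]≡0

  InD⇒root≡0 : InD T g r → toℕ (g r) ≡ 0
  InD⇒root≡0 ((¬ir , ir) , cs) with toℕ (g r) in g[r]≡
  ... | 0 = refl
  ... | 1 = ⊥-elim (¬ir (isolated-root⇒IsIR2DF (λ g[r]≡0 → 1+n≢0 (trans (sym g[r]≡) (cong toℕ g[r]≡0)))
                                               (suc-injective cs) ir))
  InD⇒root≡0 (_ , ()) | suc (suc _)

  InC⇔ : InC T g r ⇔ (IsIR2DF-except T g r × 2 ≤ nsum T g r)
  InC⇔ = mk⇔ (λ ((dom , ind) , g[r]≡0) → (g[r]≡0 , (λ v _ → dom v) , ind) , dom r (toℕ-injective g[r]≡0))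
             (λ (ex , 2≤s) → IsIR2DF-except⇒IsIR2DF 2≤s ex , proj₁ ex)

  InD⇔ : InD T g r ⇔ (IsIR2DF-except T g r × nsum T g r ≡ 1)
  InD⇔ = mk⇔ (λ d@(ir , cs) → let g[r]≡0 = InD⇒root≡0 d in
                 IsIR2DF-r⇒IsIR2DF-except g[r]≡0 ir , trans (cong (_+ nsum T g r) (sym g[r]≡0)) cs)
             (λ (ex , s≡1) → IsIR2DF-except⇒IsIR2DF-r (subst (_< 2) (sym s≡1) (s≤s (s≤s z≤n))) ex ,
                             cong₂ _+_ (proj₁ ex) s≡1)

  InE⇔ : InE T g r ⇔ (IsIR2DF-except T g r × nsum T g r ≡ 0)
  InE⇔ = mk⇔ (λ (ir , cs) → IsIR2DF-r⇒IsIR2DF-except (m+n≡0⇒m≡0 _ cs) ir , m+n≡0⇒n≡0 (toℕ (g r)) cs)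
             (λ (ex , s≡0) → IsIR2DF-except⇒IsIR2DF-r (subst (_< 2) (sym s≡0) (s≤s z≤n)) ex ,
                             cong₂ _+_ (proj₁ ex) s≡0)

AtLeastTwoCases : ℕ → ℕ → Set
AtLeastTwoCases s t = (2 ≤ s × t ≡ 2) ⊎ (2 ≤ s × t ≡ 1) ⊎ (2 ≤ s × t ≡ 0)
                    ⊎ (s ≡ 1 × t ≡ 2) ⊎ (s ≡ 1 × t ≡ 1) ⊎ (s ≡ 0 × t ≡ 2)

2≤+⇔AtLeastTwoCases : ∀ s t → t ≤ 2 → 2 ≤ s + t ⇔ AtLeastTwoCases s t
2≤+⇔AtLeastTwoCases s t t≤2 = mk⇔ (cases s t t≤2) sum≥2
  where
  cases : ∀ s t → t ≤ 2 → 2 ≤ s + t → AtLeastTwoCases s t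
  cases (suc (suc s)) 0 _ _ = inj₂ (inj₂ (inj₁ (s≤s (s≤s z≤n) , refl)))
  cases (suc (suc s)) 1 _ _ = inj₂ (inj₁ (s≤s (s≤s z≤n) , refl))
  cases (suc (suc s)) 2 _ _ = inj₁ (s≤s (s≤s z≤n) , refl)
  cases 1 1 _ _             = inj₂ (inj₂ (inj₂ (inj₂ (inj₁ (refl , refl)))))
  cases 1 2 _ _             = inj₂ (inj₂ (inj₂ (inj₁ (refl , refl))))
  cases 0 2 _ _             = inj₂ (inj₂ (inj₂ (inj₂ (inj₂ (refl , refl)))))
  cases 0 0 _ ()
  cases 0 1 _ (s≤s ())
  cases 1 0 _ (s≤s ())
  cases _ (suc (suc (suc _))) (s≤s (s≤s ())) _
  sum≥2 : AtLeastTwoCases s t → 2 ≤ s + t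
  sum≥2 (inj₁ (2≤s , _))                                 = ≤-trans 2≤s (m≤m+n s t)
  sum≥2 (inj₂ (inj₁ (2≤s , _)))                          = ≤-trans 2≤s (m≤m+n s t)
  sum≥2 (inj₂ (inj₂ (inj₁ (2≤s , _))))                   = ≤-trans 2≤s (m≤m+n s t)
  sum≥2 (inj₂ (inj₂ (inj₂ (inj₁ (refl , refl)))))        = s≤s (s≤s z≤n)
  sum≥2 (inj₂ (inj₂ (inj₂ (inj₂ (inj₁ (refl , refl)))))) = s≤s (s≤s z≤n)
  sum≥2 (inj₂ (inj₂ (inj₂ (inj₂ (inj₂ (refl , refl)))))) = s≤s (s≤s z≤n)

IsCPair : ∀ {m₁ m₂} → Graph (suc m₁) → Labelling (suc m₁) → Fin (suc m₁) →
          Graph (suc m₂) → Labelling (suc m₂) → Fin (suc m₂) → Set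
IsCPair T₁ g₁ r₁ T₂ g₂ r₂ =
    (InC T₁ g₁ r₁ × InA T₂ g₂ r₂) ⊎ (InC T₁ g₁ r₁ × InB T₂ g₂ r₂) ⊎ (InC T₁ g₁ r₁ × InC T₂ g₂ r₂)
  ⊎ (InD T₁ g₁ r₁ × InA T₂ g₂ r₂) ⊎ (InD T₁ g₁ r₁ × InB T₂ g₂ r₂) ⊎ (InE T₁ g₁ r₁ × InA T₂ g₂ r₂)

module _ {m₁ m₂} (T₁ : Graph (suc m₁)) (g₁ : Labelling (suc m₁)) (r₁ : Fin (suc m₁))
                 (T₂ : Graph (suc m₂)) (g₂ : Labelling (suc m₂)) (r₂ : Fin (suc m₂)) where

  private
    Conditions : Set
    Conditions = IsIR2DF-except T₁ g₁ r₁ × IsIR2DF T₂ g₂ × 2 ≤ nsum T₁ g₁ r₁ + toℕ (g₂ r₂)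

    weights⇔ : 2 ≤ nsum T₁ g₁ r₁ + toℕ (g₂ r₂) ⇔ AtLeastTwoCases (nsum T₁ g₁ r₁) (toℕ (g₂ r₂))
    weights⇔ = 2≤+⇔AtLeastTwoCases (nsum T₁ g₁ r₁) (toℕ (g₂ r₂)) (toℕ≤pred[n] (g₂ r₂))

  IsCPair⇔ : IsCPair T₁ g₁ r₁ T₂ g₂ r₂ ⇔ Conditions
  IsCPair⇔ = mk⇔ split join
    where
    split : IsCPair T₁ g₁ r₁ T₂ g₂ r₂ → Conditions
    split (inj₁ (c , ir , t≡2)) =
      let ex , p = to (InC⇔ T₁ r₁ g₁) c in
      ex , ir , from weights⇔ (inj₁ (p , t≡2))
    split (inj₂ (inj₁ (c , ir , t≡1))) =
      let ex , p = to (InC⇔ T₁ r₁ g₁) c in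
      ex , ir , from weights⇔ (inj₂ (inj₁ (p , t≡1)))
    split (inj₂ (inj₂ (inj₁ (c , ir , t≡0)))) =
      let ex , p = to (InC⇔ T₁ r₁ g₁) c in
      ex , ir , from weights⇔ (inj₂ (inj₂ (inj₁ (p , t≡0))))
    split (inj₂ (inj₂ (inj₂ (inj₁ (d , ir , t≡2))))) =
      let ex , p = to (InD⇔ T₁ r₁ g₁) d in
      ex , ir , from weights⇔ (inj₂ (inj₂ (inj₂ (inj₁ (p , t≡2)))))
    split (inj₂ (inj₂ (inj₂ (inj₂ (inj₁ (d , ir , t≡1)))))) =
      let ex , p = to (InD⇔ T₁ r₁ g₁) d in
      ex , ir , from weights⇔ (inj₂ (inj₂ (inj₂ (inj₂ (inj₁ (p , t≡1))))))
    split (inj₂ (inj₂ (inj₂ (inj₂ (inj₂ (e , ir , t≡2)))))) =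
      let ex , p = to (InE⇔ T₁ r₁ g₁) e in
      ex , ir , from weights⇔ (inj₂ (inj₂ (inj₂ (inj₂ (inj₂ (p , t≡2))))))

    join : Conditions → IsCPair T₁ g₁ r₁ T₂ g₂ r₂
    join (ex , ir , 2≤s+t) with to weights⇔ 2≤s+t
    ... | inj₁ (p , t≡2) =
      inj₁ (from (InC⇔ T₁ r₁ g₁) (ex , p) , ir , t≡2)
    ... | inj₂ (inj₁ (p , t≡1)) =
      inj₂ (inj₁ (from (InC⇔ T₁ r₁ g₁) (ex , p) , ir , t≡1))
    ... | inj₂ (inj₂ (inj₁ (p , t≡0))) =
      inj₂ (inj₂ (inj₁ (from (InC⇔ T₁ r₁ g₁) (ex , p) , ir , t≡0)))
    ... | inj₂ (inj₂ (inj₂ (inj₁ (p , t≡2)))) =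
      inj₂ (inj₂ (inj₂ (inj₁ (from (InD⇔ T₁ r₁ g₁) (ex , p) , ir , t≡2))))
    ... | inj₂ (inj₂ (inj₂ (inj₂ (inj₁ (p , t≡1))))) =
      inj₂ (inj₂ (inj₂ (inj₂ (inj₁ (from (InD⇔ T₁ r₁ g₁) (ex , p) , ir , t≡1)))))
    ... | inj₂ (inj₂ (inj₂ (inj₂ (inj₂ (p , t≡2))))) =
      inj₂ (inj₂ (inj₂ (inj₂ (inj₂ (from (InE⇔ T₁ r₁ g₁) (ex , p) , ir , t≡2)))))

data SplitView {n₁ n₂} : Fin (n₁ + n₂) → Set where
  left  : ∀ a → SplitView (a ↑ˡ n₂)
  right : ∀ b → SplitView (n₁ ↑ʳ b)

splitView : ∀ n₁ {n₂} (k : Fin (n₁ + n₂)) → SplitView {n₁} {n₂} k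
splitView n₁ k with splitAt n₁ k in eq
... | inj₁ a = subst SplitView (splitAt⁻¹-↑ˡ eq) (left a)
... | inj₂ b = subst SplitView (splitAt⁻¹-↑ʳ eq) (right b)

module _ {m₁ m₂} (T₁ : Graph (suc m₁)) (r₁ : Fin (suc m₁)) (T₂ : Graph (suc m₂)) (r₂ : Fin (suc m₂))
                 (f : Labelling (suc m₁ + suc m₂)) where

  private
    n₁ n₂ : ℕ
    n₁ = suc m₁
    n₂ = suc m₂
    T : Graph (n₁ + n₂)
    T = compose T₁ r₁ T₂ r₂
    f₁ : Labelling n₁
    f₁ = restrict₁ {n₁} {n₂} f
    f₂ : Labelling n₂
    f₂ = restrict₂ {n₁} {n₂} f

  adj-↑ˡ-↑ˡ : ∀ a b → adj T (a ↑ˡ n₂) (b ↑ˡ n₂) ≡ adj T₁ a b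
  adj-↑ˡ-↑ˡ a b rewrite splitAt-↑ˡ n₁ a n₂ | splitAt-↑ˡ n₁ b n₂ = refl

  adj-↑ʳ-↑ʳ : ∀ a b → adj T (n₁ ↑ʳ a) (n₁ ↑ʳ b) ≡ adj T₂ a b
  adj-↑ʳ-↑ʳ a b rewrite splitAt-↑ʳ n₁ n₂ a | splitAt-↑ʳ n₁ n₂ b = refl

  adj-↑ˡ-↑ʳ : ∀ a b → adj T (a ↑ˡ n₂) (n₁ ↑ʳ b) ≡ ⌊ a ≟ r₁ ⌋ ∧ ⌊ b ≟ r₂ ⌋
  adj-↑ˡ-↑ʳ a b rewrite splitAt-↑ˡ n₁ a n₂ | splitAt-↑ʳ n₁ n₂ b = refl

  adj-↑ʳ-↑ˡ : ∀ b a → adj T (n₁ ↑ʳ b) (a ↑ˡ n₂) ≡ ⌊ b ≟ r₂ ⌋ ∧ ⌊ a ≟ r₁ ⌋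
  adj-↑ʳ-↑ˡ b a =
    trans (adj-sym T (n₁ ↑ʳ b) (a ↑ˡ n₂)) (trans (adj-↑ˡ-↑ʳ a b) (∧-comm ⌊ a ≟ r₁ ⌋ ⌊ b ≟ r₂ ⌋))

  cross-edge⇒root : ∀ a b → adj T (a ↑ˡ n₂) (n₁ ↑ʳ b) ≡ true → a ≡ r₁
  cross-edge⇒root a b e with a ≟ r₁ | trans (sym (adj-↑ˡ-↑ʳ a b)) e
  ... | yes a≡r₁ | _ = a≡r₁
  ... | no _     | ()

  nsum-↑ˡ : ∀ a → nsum T f (a ↑ˡ n₂) ≡ nsum T₁ f₁ a + (if ⌊ a ≟ r₁ ⌋ then toℕ (f₂ r₂) else 0)
  nsum-↑ˡ a = begin
    nsum T f (a ↑ˡ n₂)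
      ≡⟨ ∑-splitAt n₁ n₂ (λ u → weight f (adj T (a ↑ˡ n₂) u) u) ⟩
    ∑ (λ i → weight f₁ (adj T (a ↑ˡ n₂) (i ↑ˡ n₂)) i) + ∑ (λ j → weight f₂ (adj T (a ↑ˡ n₂) (n₁ ↑ʳ j)) j)
      ≡⟨ cong₂ _+_ (∑-cong λ i → cong (λ b → weight f₁ b i) (adj-↑ˡ-↑ˡ a i))
                   (∑-cong λ j → cong (λ b → weight f₂ b j) (adj-↑ˡ-↑ʳ a j)) ⟩
    nsum T₁ f₁ a + ∑ (λ j → weight f₂ (⌊ a ≟ r₁ ⌋ ∧ ⌊ j ≟ r₂ ⌋) j)
      ≡⟨ cong (nsum T₁ f₁ a +_) (∑-select ⌊ a ≟ r₁ ⌋ r₂ (toℕ ∘ f₂)) ⟩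
    nsum T₁ f₁ a + (if ⌊ a ≟ r₁ ⌋ then toℕ (f₂ r₂) else 0)
      ∎
    where open ≡-Reasoning

  nsum-↑ʳ : ∀ b → nsum T f (n₁ ↑ʳ b) ≡ (if ⌊ b ≟ r₂ ⌋ then toℕ (f₁ r₁) else 0) + nsum T₂ f₂ b
  nsum-↑ʳ b = begin
    nsum T f (n₁ ↑ʳ b)
      ≡⟨ ∑-splitAt n₁ n₂ (λ u → weight f (adj T (n₁ ↑ʳ b) u) u) ⟩
    ∑ (λ i → weight f₁ (adj T (n₁ ↑ʳ b) (i ↑ˡ n₂)) i) + ∑ (λ j → weight f₂ (adj T (n₁ ↑ʳ b) (n₁ ↑ʳ j)) j)
      ≡⟨ cong₂ _+_ (∑-cong λ i → cong (λ c → weight f₁ c i) (adj-↑ʳ-↑ˡ b i))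
                   (∑-cong λ j → cong (λ c → weight f₂ c j) (adj-↑ʳ-↑ʳ b j)) ⟩
    ∑ (λ i → weight f₁ (⌊ b ≟ r₂ ⌋ ∧ ⌊ i ≟ r₁ ⌋) i) + nsum T₂ f₂ b
      ≡⟨ cong (_+ nsum T₂ f₂ b) (∑-select ⌊ b ≟ r₂ ⌋ r₁ (toℕ ∘ f₁)) ⟩
    (if ⌊ b ≟ r₂ ⌋ then toℕ (f₁ r₁) else 0) + nsum T₂ f₂ b
      ∎
    where open ≡-Reasoning

  nsum-root : nsum T f (r₁ ↑ˡ n₂) ≡ nsum T₁ f₁ r₁ + toℕ (f₂ r₂)
  nsum-root with r₁ ≟ r₁ | nsum-↑ˡ r₁
  ... | yes _   | eq = eq
  ... | no r≢r  | _  = ⊥-elim (r≢r refl)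

  nsum-↑ˡ-nonroot : ∀ a → a ≢ r₁ → nsum T f (a ↑ˡ n₂) ≡ nsum T₁ f₁ a
  nsum-↑ˡ-nonroot a a≢r₁ with a ≟ r₁ | nsum-↑ˡ a
  ... | yes a≡r₁ | _  = ⊥-elim (a≢r₁ a≡r₁)
  ... | no _     | eq = trans eq (+-identityʳ (nsum T₁ f₁ a))

  nsum-↑ʳ-unlabelled-root : toℕ (f₁ r₁) ≡ 0 → ∀ b → nsum T f (n₁ ↑ʳ b) ≡ nsum T₂ f₂ b
  nsum-↑ʳ-unlabelled-root f[r₁]≡0 b =
    trans (nsum-↑ʳ b) (cong (_+ nsum T₂ f₂ b) (if-then-0 ⌊ b ≟ r₂ ⌋ f[r₁]≡0))

  InC-compose⇒ : InC T f (r₁ ↑ˡ n₂) →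
                 IsIR2DF-except T₁ f₁ r₁ × IsIR2DF T₂ f₂ × 2 ≤ nsum T₁ f₁ r₁ + toℕ (f₂ r₂)
  InC-compose⇒ ((dom , ind) , f[r₁]≡0) =
    (f[r₁]≡0 , dom₁ , (λ u v → ind (u ↑ˡ n₂) (v ↑ˡ n₂) ∘ trans (adj-↑ˡ-↑ˡ u v))) ,
    (dom₂ , (λ u v → ind (n₁ ↑ʳ u) (n₁ ↑ʳ v) ∘ trans (adj-↑ʳ-↑ʳ u v))) ,
    subst (2 ≤_) nsum-root (dom (r₁ ↑ˡ n₂) (toℕ-injective f[r₁]≡0))
    where
    dom₁ : DominatedAwayFrom T₁ f₁ r₁
    dom₁ a a≢r₁ f[a]≡0 = subst (2 ≤_) (nsum-↑ˡ-nonroot a a≢r₁) (dom (a ↑ˡ n₂) f[a]≡0)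
    dom₂ : ∀ b → f₂ b ≡ zero → 2 ≤ nsum T₂ f₂ b
    dom₂ b f[b]≡0 = subst (2 ≤_) (nsum-↑ʳ-unlabelled-root f[r₁]≡0 b) (dom (n₁ ↑ʳ b) f[b]≡0)

  ⇒InC-compose : IsIR2DF-except T₁ f₁ r₁ → IsIR2DF T₂ f₂ → 2 ≤ nsum T₁ f₁ r₁ + toℕ (f₂ r₂) →
                 InC T f (r₁ ↑ˡ n₂)
  ⇒InC-compose (f[r₁]≡0 , dom₁ , ind₁) (dom₂ , ind₂) 2≤s+t = (dom , ind) , f[r₁]≡0
    where
    dom : ∀ k → f k ≡ zero → 2 ≤ nsum T f k
    dom k f[k]≡0 with splitView n₁ k
    dom _ f[k]≡0 | left a with a ≟ r₁
    ... | yes refl = subst (2 ≤_) (sym nsum-root) 2≤s+t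
    ... | no a≢r₁  = subst (2 ≤_) (sym (nsum-↑ˡ-nonroot a a≢r₁)) (dom₁ a a≢r₁ f[k]≡0)
    dom _ f[k]≡0 | right b = subst (2 ≤_) (sym (nsum-↑ʳ-unlabelled-root f[r₁]≡0 b)) (dom₂ b f[k]≡0)
    ind : Independent T f
    ind u v uv with splitView n₁ u | splitView n₁ v
    ... | left a  | left b  = ind₁ a b (trans (sym (adj-↑ˡ-↑ˡ a b)) uv)
    ... | right a | right b = ind₂ a b (trans (sym (adj-↑ʳ-↑ʳ a b)) uv)
    ... | left a  | right b with cross-edge⇒root a b uv
    ...   | refl = inj₁ (toℕ-injective f[r₁]≡0)
    ind u v uv | right b | left a with cross-edge⇒root a b (trans (adj-sym T (a ↑ˡ n₂) (n₁ ↑ʳ b)) uv)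
    ...   | refl = inj₂ (toℕ-injective f[r₁]≡0)

  InC-compose⇔ : InC T f (r₁ ↑ˡ n₂) ⇔
                 (IsIR2DF-except T₁ f₁ r₁ × IsIR2DF T₂ f₂ × 2 ≤ nsum T₁ f₁ r₁ + toℕ (f₂ r₂))
  InC-compose⇔ = mk⇔ InC-compose⇒ (λ (ex , ir , 2≤s+t) → ⇒InC-compose ex ir 2≤s+t)

lemma4 : ∀ {m₁ m₂ : ℕ} (T₁ : Graph (suc m₁)) (T₂ : Graph (suc m₂)) →
         IsTree T₁ → IsTree T₂ →
         (r₁ : Fin (suc m₁)) (r₂ : Fin (suc m₂)) →
         (f : Labelling (suc m₁ + suc m₂)) →
         InC (compose T₁ r₁ T₂ r₂) f (r₁ ↑ˡ suc m₂)
         ⇔ ((InC T₁ (restrict₁ f) r₁ × InA T₂ (restrict₂ {suc m₁} f) r₂)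
           ⊎ (InC T₁ (restrict₁ f) r₁ × InB T₂ (restrict₂ {suc m₁} f) r₂)
           ⊎ (InC T₁ (restrict₁ f) r₁ × InC T₂ (restrict₂ {suc m₁} f) r₂)
           ⊎ (InD T₁ (restrict₁ f) r₁ × InA T₂ (restrict₂ {suc m₁} f) r₂)
           ⊎ (InD T₁ (restrict₁ f) r₁ × InB T₂ (restrict₂ {suc m₁} f) r₂)
           ⊎ (InE T₁ (restrict₁ f) r₁ × InA T₂ (restrict₂ {suc m₁} f) r₂))
lemma4 {m₁} T₁ T₂ _ _ r₁ r₂ f =
  ⇔-sym (IsCPair⇔ T₁ (restrict₁ f) r₁ T₂ (restrict₂ {suc m₁} f) r₂) ⇔-∘ InC-compose⇔ T₁ r₁ T₂ r₂ f
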